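{- (Correctness of first-order intuitionistic logic.) For every set of formulas $\Gamma$ and formula $\alpha$ of a first-order language, if $\Gamma\vdash_{\texttt{IL}}\alpha$ then $\Gamma\models\alpha$.
   Context: $\texttt{IL}$ is Gentzen's natural deduction system for first-order intuitionistic logic (with $\bot$, $\wedge,\vee,\rightarrow,\forall,\exists$, $\neg\alpha:=\alpha\rightarrow\bot$). Atomic base $\mathfrak{B}$ on a first-order language $L$: the constants of $L$ plus an atomic system $\texttt{S}$ (recursively axiomatisable rules from atomic premises other than $\bot$ to atomic or $\bot$ conclusions), with a domain of individuals. Grounds on $\mathfrak{B}$ for closed $\alpha$: closed derivations in $\texttt{S}$ for atomic $\alpha$; $\wedge I(g_1,g_2)$, $\vee I(g)$, $\rightarrow I\xi^\alpha(f)$ ($f$ a ground for $\alpha\vdash\beta$), $\exists I(g)$, $\forall Ix(f)$ ($f$ a ground for $\vdash\alpha(x)$); none for $\bot$; nothing else. A $\mathfrak{B}$-operation on grounds of operational type $\tau_1,\dots,\tau_n\rhd\beta$ (entries formulas or first-level types $\Gamma\rhd\gamma$) is a total constructive function given by defining equations mapping individuals and grounds (or first-level operations) for the instantiated entries to grounds for the instantiated co-domain, possibly binding individual variables and typed variables (discharging assumptions) on entries; it is a proper ground if it uses no individual arguments beyond those required by its type. Identity across bases $\approx_{\mathfrak{B}_1,\mathfrak{B}_2}$: built from operations with the same defining equations (same computation instructions) on identical arguments, or the same atomic derivation. A ground $g_1$ on $\mathfrak{B}_1$ over $L_1$ is universal iff for every expansion $L_2$ of $L_1$ and every base $\mathfrak{B}_2$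 on $L_2$ there is a ground $g_2$ on $\mathfrak{B}_2$ with $g_1\approx_{\mathfrak{B}_1,\mathfrak{B}_2}g_2$. An inference $\alpha_1,\dots,\alpha_n/\beta$ on $L$ (possibly binding individual variables and discharging assumptions) is valid over $\mathfrak{B}$ iff there is a $\mathfrak{B}$-operation on grounds $f$ of type $\tau_1,\dots,\tau_n\rhd\beta$, proper ground, where $\tau_i$ is $\alpha_i$ if nothing is discharged on $\alpha_i$ and $\Gamma\rhd\alpha_i$ if $\Gamma$ is discharged on $\alpha_i$, and $f$ binds $x$ and $\xi^\gamma$ on index $i$ iff the inference binds $x$ and discharges $\gamma$ on $\alpha_i$; it is logically valid iff such an $f$ is a universal ground. $\Gamma\models\alpha$ (logical consequence) iff there is a proof of $\alpha$ from $\Gamma$, i.e. a chain of inferences, involving only logically valid inferences; equivalently, iff some composition of universal operations on grounds results in a universal operation on grounds of type $\Gamma\rhd\alpha$. -}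

module Defs where

open import Data.Nat using (ℕ; zero; suc)
open import Data.Vec using (Vec; []; _∷_)
open import Data.List using (List; []; _∷_; map)
open import Data.List.Membership.Propositional using (_∈_)
open import Data.List.Relation.Unary.All using (All)
open import Data.Product using (Σ; _×_; _,_)
open import Data.Sum using (_⊎_)
open import Data.Empty using (⊥)

record Signature : Set₁ where
  field
    FunSym  : Set
    funAr   : FunSym → ℕ
    PredSym : Set
    predAr  : PredSym → ℕ
open Signature public

module _ (L : Signature) where

  -- terms, individual variables as de Bruijn indices
  data Term : Set where
    var : ℕ → Term
    fun : (f : FunSym L) → Vec Term (funAr L f) → Term

  -- formulas; ∀' and ∃' bind variable 0
  data Formula : Set where
    atom : (P : PredSym L) → Vec Term (predAr L P) → Formula
    ⊥'   : Formula
    _∧'_ _∨'_ _⇒'_ : Formula → Formula → Formula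
    ∀' ∃' : Formula → Formula

module _ {L : Signature} where

  Ren : Set
  Ren = ℕ → ℕ

  liftR : Ren → Ren
  liftR r zero    = zero
  liftR r (suc n) = suc (r n)

  mutual
    renT : Ren → Term L → Term L
    renT r (var x)    = var (r x)
    renT r (fun f ts) = fun f (renTs r ts)

    renTs : ∀ {n} → Ren → Vec (Term L) n → Vec (Term L) n
    renTs r []       = []
    renTs r (t ∷ ts) = renT r t ∷ renTs r ts

  renF : Ren → Formula L → Formula L
  renF r (atom P ts) = atom P (renTs r ts)
  renF r ⊥'          = ⊥'
  renF r (a ∧' b)    = renF r a ∧' renF r b
  renF r (a ∨' b)    = renF r a ∨' renF r b
  renF r (a ⇒' b)    = renF r a ⇒' renF r b
  renF r (∀' a)      = ∀' (renF (liftR r) a)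
  renF r (∃' a)      = ∃' (renF (liftR r) a)

  shiftF : Formula L → Formula L
  shiftF = renF suc

  Sub : Set
  Sub = ℕ → Term L

  liftS : Sub → Sub
  liftS s zero    = var zero
  liftS s (suc n) = renT suc (s n)

  mutual
    subT : Sub → Term L → Term L
    subT s (var x)    = s x
    subT s (fun f ts) = fun f (subTs s ts)

    subTs : ∀ {n} → Sub → Vec (Term L) n → Vec (Term L) n
    subTs s []       = []
    subTs s (t ∷ ts) = subT s t ∷ subTs s ts

  subF : Sub → Formula L → Formula L
  subF s (atom P ts) = atom P (subTs s ts)
  subF s ⊥'          = ⊥'
  subF s (a ∧' b)    = subF s a ∧' subF s b
  subF s (a ∨' b)    = subF s a ∨' subF s b
  subF s (a ⇒' b)    = subF s a ⇒' subF s b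
  subF s (∀' a)      = ∀' (subF (liftS s) a)
  subF s (∃' a)      = ∃' (subF (liftS s) a)

  _[_] : Formula L → Term L → Formula L
  a [ t ] = subF (λ { zero → t ; (suc n) → var n }) a

  -- IL: Gentzen's natural deduction for intuitionistic first-order logic
  -- (open assumptions as a list; eigenvariable condition via de Bruijn
  -- shifting)

  infix 3 _⊢ᴺ_
  data _⊢ᴺ_ : List (Formula L) → Formula L → Set where
    hyp  : ∀ {Δ a} → a ∈ Δ → Δ ⊢ᴺ a
    ⊥E   : ∀ {Δ a} → Δ ⊢ᴺ ⊥' → Δ ⊢ᴺ a
    ∧I   : ∀ {Δ a b} → Δ ⊢ᴺ a → Δ ⊢ᴺ b → Δ ⊢ᴺ a ∧' b
    ∧E₁  : ∀ {Δ a b} → Δ ⊢ᴺ a ∧' b → Δ ⊢ᴺ a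
    ∧E₂  : ∀ {Δ a b} → Δ ⊢ᴺ a ∧' b → Δ ⊢ᴺ b
    ∨I₁  : ∀ {Δ a b} → Δ ⊢ᴺ a → Δ ⊢ᴺ a ∨' b
    ∨I₂  : ∀ {Δ a b} → Δ ⊢ᴺ b → Δ ⊢ᴺ a ∨' b
    ∨E   : ∀ {Δ a b c} → Δ ⊢ᴺ a ∨' b → (a ∷ Δ) ⊢ᴺ c → (b ∷ Δ) ⊢ᴺ c → Δ ⊢ᴺ c
    ⇒I   : ∀ {Δ a b} → (a ∷ Δ) ⊢ᴺ b → Δ ⊢ᴺ a ⇒' b
    ⇒E   : ∀ {Δ a b} → Δ ⊢ᴺ a ⇒' b → Δ ⊢ᴺ a → Δ ⊢ᴺ b
    ∀I   : ∀ {Δ a} → map shiftF Δ ⊢ᴺ a → Δ ⊢ᴺ ∀' a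
    ∀E   : ∀ {Δ a} → Δ ⊢ᴺ ∀' a → (t : Term L) → Δ ⊢ᴺ a [ t ]
    ∃I   : ∀ {Δ a} (t : Term L) → Δ ⊢ᴺ a [ t ] → Δ ⊢ᴺ ∃' a
    ∃E   : ∀ {Δ a c} → Δ ⊢ᴺ ∃' a → (a ∷ map shiftF Δ) ⊢ᴺ shiftF c → Δ ⊢ᴺ c

  _⊢IL_ : (Formula L → Set) → Formula L → Set
  Γ ⊢IL a = Σ (List (Formula L)) λ Δ → All Γ Δ × (Δ ⊢ᴺ a)

-- A "base situation" for L: a domain of individuals, an
-- interpretation of the symbols of L (covering any expansion L₂ of L,
-- whose extra symbols are irrelevant to L-formulas), and for every
-- atomic predicate and tuple of individuals the set of its grounds
-- (for an atomic base: closed derivations in the atomic system S).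

record Base (L : Signature) : Set₁ where
  field
    Dom      : Set
    funI     : (f : FunSym L) → Vec Dom (funAr L f) → Dom
    AtomGrd  : (P : PredSym L) → Vec Dom (predAr L P) → Set
open Base public

module _ {L : Signature} (B : Base L) where

  Env : Set
  Env = ℕ → Dom B

  _∷ₑ_ : Dom B → Env → Env
  (d ∷ₑ ρ) zero    = d
  (d ∷ₑ ρ) (suc n) = ρ n

  mutual
    ⟦_⟧t : Term L → Env → Dom B
    ⟦ var x ⟧t ρ    = ρ x
    ⟦ fun f ts ⟧t ρ = funI B f (⟦ ts ⟧ts ρ)

    ⟦_⟧ts : ∀ {n} → Vec (Term L) n → Env → Vec (Dom B) n
    ⟦ [] ⟧ts ρ     = []
    ⟦ t ∷ ts ⟧ts ρ = ⟦ t ⟧t ρ ∷ ⟦ ts ⟧ts ρ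

  -- Ground a ρ : the grounds on B for the closed instance of a under ρ.
  -- ⊥ has no grounds; →I / ∀I grounds are operations on grounds.
  Ground : Formula L → Env → Set
  Ground (atom P ts) ρ = AtomGrd B P (⟦ ts ⟧ts ρ)
  Ground ⊥'          ρ = ⊥
  Ground (a ∧' b)    ρ = Ground a ρ × Ground b ρ
  Ground (a ∨' b)    ρ = Ground a ρ ⊎ Ground b ρ
  Ground (a ⇒' b)    ρ = Ground a ρ → Ground b ρ
  Ground (∀' a)      ρ = (d : Dom B) → Ground a (d ∷ₑ ρ)
  Ground (∃' a)      ρ = Σ (Dom B) λ d → Ground a (d ∷ₑ ρ)

-- A universal operation on grounds of type Δ ▷ a: ONE operation (a single
-- term, hence the same defining equations) which, for every base over
-- every expansion of L and every assignment of individuals to the free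
-- individual variables, maps grounds for the instances of Δ to a ground
-- for the instance of a.
UniversalOp : {L : Signature} → List (Formula L) → Formula L → Set₁
UniversalOp {L} Δ a =
  (B : Base L) (ρ : Env B) → All (λ g → Ground B g ρ) Δ → Ground B a ρ

_⊨_ : {L : Signature} → (Formula L → Set) → Formula L → Set₁
_⊨_ {L} Γ a = Σ (List (Formula L)) λ Δ → All Γ Δ × UniversalOp Δ a

{-# OPTIONS --safe #-}
-- Every rule of IL denotes an operation on grounds whose defining equations
-- do not mention the base: introductions are the ground constructors and
-- eliminations are given by the reduction equations.  Interpreting a
-- derivation rule by rule therefore yields one operation that works over
-- every base, i.e. a universal one.  The quantifier rules additionally need
-- that grounds are invariant under renaming and substitution of terms with
-- the same denotation.
module Submission where

open import Defs
open import Data.Nat using (zero; suc)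
open import Data.Vec using (Vec; []; _∷_)
open import Data.List using (List; map)
open import Data.List.Relation.Unary.All as All using (All; _∷_)
open import Data.List.Relation.Unary.All.Properties using (map⁺)
open import Data.Product using (_,_; proj₁; proj₂)
open import Data.Product.Function.NonDependent.Propositional using (_×-⇔_)
open import Data.Product.Function.Dependent.Propositional using (Σ-⇔)
open import Data.Sum using (inj₁; inj₂)
open import Data.Sum.Function.Propositional using (_⊎-⇔_)
open import Data.Empty using (⊥-elim)
open import Function using (_∘_; _⇔_; mk⇔; Equivalence)
open import Function.Construct.Identity using (⇔-id; ↠-id)
open import Function.Related.TypeIsomorphisms using (→-cong-⇔)
open import Relation.Binary.PropositionalEquality
  using (_≡_; refl; sym; trans; cong; cong₂; subst; _≗_)

open Equivalence using (to; from)

Π-⇔ : ∀ {D : Set} {A B : D → Set} → (∀ d → A d ⇔ B d) →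
      ((d : D) → A d) ⇔ ((d : D) → B d)
Π-⇔ A⇔B = mk⇔ (λ f d → to (A⇔B d) (f d)) (λ g d → from (A⇔B d) (g d))

module _ {L : Signature} (B : Base L) where

  ⟦_⟧ : Term L → Env B → Dom B
  ⟦_⟧ = ⟦_⟧t B

  ⟦_⟧* : ∀ {n} → Vec (Term L) n → Env B → Vec (Dom B) n
  ⟦_⟧* = ⟦_⟧ts B

  infixr 5 _∷ᴱ_
  _∷ᴱ_ : Dom B → Env B → Env B
  _∷ᴱ_ = _∷ₑ_ B

  ⟦_⟧ˢ : Sub {L} → Env B → Env B
  ⟦ s ⟧ˢ ρ x = ⟦ s x ⟧ ρ

  Grounds : List (Formula L) → Env B → Set
  Grounds Δ ρ = All (λ a → Ground B a ρ) Δ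

  mutual
    ⟦renT⟧ : ∀ r {ρ σ} → ρ ∘ r ≗ σ → (t : Term L) → ⟦ renT r t ⟧ ρ ≡ ⟦ t ⟧ σ
    ⟦renT⟧ r ρr≗σ (var x)    = ρr≗σ x
    ⟦renT⟧ r ρr≗σ (fun f ts) = cong (funI B f) (⟦renTs⟧ r ρr≗σ ts)

    ⟦renTs⟧ : ∀ {n} r {ρ σ} → ρ ∘ r ≗ σ →
              (ts : Vec (Term L) n) → ⟦ renTs r ts ⟧* ρ ≡ ⟦ ts ⟧* σ
    ⟦renTs⟧ r ρr≗σ []       = refl
    ⟦renTs⟧ r ρr≗σ (t ∷ ts) = cong₂ _∷_ (⟦renT⟧ r ρr≗σ t) (⟦renTs⟧ r ρr≗σ ts)

  ⟦renT-suc⟧ : ∀ {d ρ} (t : Term L) → ⟦ renT suc t ⟧ (d ∷ᴱ ρ) ≡ ⟦ t ⟧ ρ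
  ⟦renT-suc⟧ = ⟦renT⟧ suc (λ _ → refl)

  mutual
    ⟦subT⟧ : ∀ s {ρ σ} → ⟦ s ⟧ˢ ρ ≗ σ → (t : Term L) → ⟦ subT s t ⟧ ρ ≡ ⟦ t ⟧ σ
    ⟦subT⟧ s sρ≗σ (var x)    = sρ≗σ x
    ⟦subT⟧ s sρ≗σ (fun f ts) = cong (funI B f) (⟦subTs⟧ s sρ≗σ ts)

    ⟦subTs⟧ : ∀ {n} s {ρ σ} → ⟦ s ⟧ˢ ρ ≗ σ →
              (ts : Vec (Term L) n) → ⟦ subTs s ts ⟧* ρ ≡ ⟦ ts ⟧* σ
    ⟦subTs⟧ s sρ≗σ []       = refl
    ⟦subTs⟧ s sρ≗σ (t ∷ ts) = cong₂ _∷_ (⟦subT⟧ s sρ≗σ t) (⟦subTs⟧ s sρ≗σ ts)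

  liftR-≗ : ∀ {r : Ren {L}} {ρ σ} d → ρ ∘ r ≗ σ → (d ∷ᴱ ρ) ∘ liftR {L} r ≗ d ∷ᴱ σ
  liftR-≗ d ρr≗σ zero    = refl
  liftR-≗ d ρr≗σ (suc x) = ρr≗σ x

  liftS-≗ : ∀ {s : Sub {L}} {ρ σ} d → ⟦ s ⟧ˢ ρ ≗ σ → ⟦ liftS s ⟧ˢ (d ∷ᴱ ρ) ≗ d ∷ᴱ σ
  liftS-≗ d sρ≗σ zero        = refl
  liftS-≗ {s} d sρ≗σ (suc x) = trans (⟦renT-suc⟧ (s x)) (sρ≗σ x)

  Ground-renF : ∀ r {ρ σ} → ρ ∘ r ≗ σ → (a : Formula L) →
                Ground B (renF r a) ρ ⇔ Ground B a σ
  Ground-renF r ρr≗σ (atom P ts) =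
    mk⇔ (subst (AtomGrd B P) eq) (subst (AtomGrd B P) (sym eq))
    where eq = ⟦renTs⟧ r ρr≗σ ts
  Ground-renF r ρr≗σ ⊥'       = ⇔-id _
  Ground-renF r ρr≗σ (a ∧' b) = Ground-renF r ρr≗σ a ×-⇔ Ground-renF r ρr≗σ b
  Ground-renF r ρr≗σ (a ∨' b) = Ground-renF r ρr≗σ a ⊎-⇔ Ground-renF r ρr≗σ b
  Ground-renF r ρr≗σ (a ⇒' b) = →-cong-⇔ (Ground-renF r ρr≗σ a) (Ground-renF r ρr≗σ b)
  Ground-renF r ρr≗σ (∀' a)   = Π-⇔ λ d → Ground-renF (liftR {L} r) (liftR-≗ d ρr≗σ) a
  Ground-renF r ρr≗σ (∃' a)   = Σ-⇔ (↠-id _) λ {d} → Ground-renF (liftR {L} r) (liftR-≗ d ρr≗σ) a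

  Ground-subF : ∀ s {ρ σ} → ⟦ s ⟧ˢ ρ ≗ σ → (a : Formula L) →
                Ground B (subF s a) ρ ⇔ Ground B a σ
  Ground-subF s sρ≗σ (atom P ts) =
    mk⇔ (subst (AtomGrd B P) eq) (subst (AtomGrd B P) (sym eq))
    where eq = ⟦subTs⟧ s sρ≗σ ts
  Ground-subF s sρ≗σ ⊥'       = ⇔-id _
  Ground-subF s sρ≗σ (a ∧' b) = Ground-subF s sρ≗σ a ×-⇔ Ground-subF s sρ≗σ b
  Ground-subF s sρ≗σ (a ∨' b) = Ground-subF s sρ≗σ a ⊎-⇔ Ground-subF s sρ≗σ b
  Ground-subF s sρ≗σ (a ⇒' b) = →-cong-⇔ (Ground-subF s sρ≗σ a) (Ground-subF s sρ≗σ b)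
  Ground-subF s sρ≗σ (∀' a)   = Π-⇔ λ d → Ground-subF (liftS s) (liftS-≗ d sρ≗σ) a
  Ground-subF s sρ≗σ (∃' a)   = Σ-⇔ (↠-id _) λ {d} → Ground-subF (liftS s) (liftS-≗ d sρ≗σ) a

  Ground-shiftF : ∀ {d ρ} (a : Formula L) → Ground B (shiftF a) (d ∷ᴱ ρ) ⇔ Ground B a ρ
  Ground-shiftF = Ground-renF suc (λ _ → refl)

  Ground-[] : ∀ {ρ} (a : Formula L) (t : Term L) →
              Ground B (a [ t ]) ρ ⇔ Ground B a (⟦ t ⟧ ρ ∷ᴱ ρ)
  Ground-[] a t = Ground-subF _ (λ { zero → refl ; (suc x) → refl }) a

  Grounds-shiftF : ∀ {Δ d ρ} → Grounds Δ ρ → Grounds (map shiftF Δ) (d ∷ᴱ ρ)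
  Grounds-shiftF gs = map⁺ (All.map (λ {a} → from (Ground-shiftF a)) gs)

  soundness : ∀ {Δ a} → Δ ⊢ᴺ a → ∀ ρ → Grounds Δ ρ → Ground B a ρ
  soundness (hyp a∈Δ)   ρ gs = All.lookup gs a∈Δ
  soundness (⊥E d)      ρ gs = ⊥-elim (soundness d ρ gs)
  soundness (∧I d e)    ρ gs = soundness d ρ gs , soundness e ρ gs
  soundness (∧E₁ d)     ρ gs = proj₁ (soundness d ρ gs)
  soundness (∧E₂ d)     ρ gs = proj₂ (soundness d ρ gs)
  soundness (∨I₁ d)     ρ gs = inj₁ (soundness d ρ gs)
  soundness (∨I₂ d)     ρ gs = inj₂ (soundness d ρ gs)
  soundness (∨E d e f)  ρ gs with soundness d ρ gs
  ... | inj₁ g = soundness e ρ (g ∷ gs)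
  ... | inj₂ g = soundness f ρ (g ∷ gs)
  soundness (⇒I d)      ρ gs = λ g → soundness d ρ (g ∷ gs)
  soundness (⇒E d e)    ρ gs = soundness d ρ gs (soundness e ρ gs)
  soundness (∀I d)      ρ gs = λ x → soundness d (x ∷ᴱ ρ) (Grounds-shiftF gs)
  soundness (∀E {a = a} d t) ρ gs = from (Ground-[] a t) (soundness d ρ gs (⟦ t ⟧ ρ))
  soundness (∃I {a = a} t d) ρ gs = ⟦ t ⟧ ρ , to (Ground-[] a t) (soundness d ρ gs)
  soundness (∃E {c = c} d e) ρ gs with soundness d ρ gs
  ... | x , g = to (Ground-shiftF c) (soundness e (x ∷ᴱ ρ) (g ∷ Grounds-shiftF gs))

⊢ᴺ⇒UniversalOp : ∀ {L} {Δ : List (Formula L)} {a : Formula L} → Δ ⊢ᴺ a → UniversalOp Δ a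
⊢ᴺ⇒UniversalOp d B = soundness B d

theorem29 : (L : Signature) (Γ : Formula L → Set) (α : Formula L) →
    Γ ⊢IL α → Γ ⊨ α
theorem29 L Γ α (Δ , Δ⊆Γ , d) = Δ , Δ⊆Γ , ⊢ᴺ⇒UniversalOp d
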